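{- Let $X$ be a set equipped with a binary operation $\ast$ and a distinguished element $0 \in X$. Then the following two conditions are equivalent: (1) For all $x, y, z \in X$: (B1) $x \ast x = 0$; (B2) if $x \ast y = 0$ and $y \ast x = 0$ then $x = y$; (B3) $(x \ast y) \ast z = (x \ast z) \ast y$. (2) For all $x, y, z \in X$: (G) $((x \ast y) \ast z) \ast ((x \ast (z \ast 0)) \ast y) = 0$; (A3) if $x \ast y = 0$ and $y \ast x = 0$ then $x = y$. In particular, $\{G, A3\}$ axiomatizes exactly the class of BCH-algebras.
   Context: An algebra of type $(2,0)$ is a set $X$ with a binary operation $\ast$ and a constant $0$. A BCH-algebra is such an algebra satisfying, for all $x,y,z$, the axioms (B1) $x\ast x=0$, (B2) $x\ast y=0$ and $y\ast x=0$ imply $x=y$, and (B3) $(x\ast y)\ast z=(x\ast z)\ast y$. -}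

module Defs where

open import Level using (Level; _⊔_)
open import Data.Product using (_×_)
open import Function.Bundles using (_⇔_)
open import Relation.Binary.PropositionalEquality using (_≡_)

IsBCH : ∀ {a} (X : Set a) (_*_ : X → X → X) (𝟘 : X) → Set a
IsBCH X _*_ 𝟘 =
  (∀ x → x * x ≡ 𝟘)
  × (∀ x y → x * y ≡ 𝟘 → y * x ≡ 𝟘 → x ≡ y)
  × (∀ x y z → (x * y) * z ≡ (x * z) * y)

IsGA3 : ∀ {a} (X : Set a) (_*_ : X → X → X) (𝟘 : X) → Set a
IsGA3 X _*_ 𝟘 =
  (∀ x y z → ((x * y) * z) * ((x * (z * 𝟘)) * y) ≡ 𝟘)
  × (∀ x y → x * y ≡ 𝟘 → y * x ≡ 𝟘 → x ≡ y)

{-# OPTIONS --safe #-}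
module Submission where

open import Data.Product using (_,_)
open import Function.Bundles using (_⇔_; mk⇔)
open import Relation.Binary.PropositionalEquality
  using (_≡_; sym; trans; cong; cong₂; subst; subst₂; module ≡-Reasoning)

open import Defs

-- Write x ≤ y for x * y = 0 and x ′ for x * 0.  In a BCH-algebra x ′ = x, and G is then
-- (B3) followed by (B1).  Conversely, every step from {G, A3} is an instance of G in which
-- one of the two inner products is already known to vanish.  Such instances first give
-- 0 ′ = 0; after that, G at (0, 0, x) and (0, x, 0) shows that x ≤ 0 forces 0 ≤ x, so by
-- A3 the only element below 0 is 0 itself.  With that, x ≤ x ′ and x ′ ≤ x follow from G
-- by a few more such collapses, so x ′ = x; then G is (B3) up to A3, and x ≤ x ′ is (B1).

module _ {a} {X : Set a} (_*_ : X → X → X) (𝟘 : X) where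

  open ≡-Reasoning

  infix 4 _≤_
  infixl 30 _′

  _≤_ : X → X → Set a
  x ≤ y = x * y ≡ 𝟘

  _′ : X → X
  x ′ = x * 𝟘

  module FromBCH
    (B1 : ∀ x → x * x ≡ 𝟘)
    (B2 : ∀ x y → x ≤ y → y ≤ x → x ≡ y)
    (B3 : ∀ x y z → (x * y) * z ≡ (x * z) * y)
    where

    x′≤x : ∀ x → x ′ ≤ x
    x′≤x x = begin
      (x * 𝟘) * x  ≡⟨ B3 x 𝟘 x ⟩
      (x * x) * 𝟘  ≡⟨ cong (_* 𝟘) (B1 x) ⟩
      𝟘 * 𝟘        ≡⟨ B1 𝟘 ⟩
      𝟘            ∎

    x*[x*y]≤y : ∀ x y → x * (x * y) ≤ y
    x*[x*y]≤y x y = trans (B3 x (x * y) y) (B1 (x * y))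

    ≤𝟘⇒≡𝟘 : ∀ {x} → x ≤ 𝟘 → x ≡ 𝟘
    ≤𝟘⇒≡𝟘 {x} x≤𝟘 = B2 x 𝟘 x≤𝟘 (subst (λ t → t * x ≡ 𝟘) x≤𝟘 (x′≤x x))

    x′≡x : ∀ x → x ′ ≡ x
    x′≡x x = B2 (x ′) x (x′≤x x) (≤𝟘⇒≡𝟘 (x*[x*y]≤y x 𝟘))

    G : ∀ x y z → (x * y) * z ≤ (x * z ′) * y
    G x y z = begin
      ((x * y) * z) * ((x * z ′) * y)  ≡⟨ cong (λ t → ((x * y) * z) * ((x * t) * y)) (x′≡x z) ⟩
      ((x * y) * z) * ((x * z) * y)    ≡⟨ cong (((x * y) * z) *_) (sym (B3 x y z)) ⟩
      ((x * y) * z) * ((x * y) * z)    ≡⟨ B1 ((x * y) * z) ⟩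
      𝟘                                ∎

  module FromGA3
    (G  : ∀ x y z → (x * y) * z ≤ (x * z ′) * y)
    (A3 : ∀ x y → x ≤ y → y ≤ x → x ≡ y)
    where

    u*z≤w≤𝟘⇒𝟘≤u′*z : ∀ {u z w} → u * z ≤ w → w ≤ 𝟘 → 𝟘 ≤ u ′ * z
    u*z≤w≤𝟘⇒𝟘≤u′*z {u} {z} {w} u*z≤w w≤𝟘 = begin
      𝟘 * ((u * 𝟘) * z)                ≡⟨ cong₂ (λ s t → s * ((u * t) * z)) (sym u*z≤w) (sym w≤𝟘) ⟩
      ((u * z) * w) * ((u * w ′) * z)  ≡⟨ G u z w ⟩
      𝟘                                ∎

    u≤w′⇒[u*y]*w≤𝟘*y : ∀ {u w} y → u ≤ w ′ → (u * y) * w ≤ 𝟘 * y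
    u≤w′⇒[u*y]*w≤𝟘*y {u} {w} y u≤w′ =
      subst (λ t → (u * y) * w ≤ t * y) u≤w′ (G u y w)

    u≤w′⇒𝟘*w≤𝟘*w′ : ∀ {u w} → u ≤ w ′ → 𝟘 * w ≤ 𝟘 * w ′
    u≤w′⇒𝟘*w≤𝟘*w′ {u} {w} u≤w′ =
      subst (λ t → t * w ≤ 𝟘 * w ′) u≤w′ (u≤w′⇒[u*y]*w≤𝟘*y (w ′) u≤w′)

    u*z′≤v⇒[u*v]*z≤𝟘 : ∀ {u v} z → u * z ′ ≤ v → (u * v) * z ≤ 𝟘
    u*z′≤v⇒[u*v]*z≤𝟘 {u} {v} z u*z′≤v =
      subst (λ t → (u * v) * z ≤ t) u*z′≤v (G u v z)

    [[x*y]*[[x*z′′]*y]]*z≤𝟘 : ∀ x y z → ((x * y) * ((x * z ′ ′) * y)) * z ≤ 𝟘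
    [[x*y]*[[x*z′′]*y]]*z≤𝟘 x y z = u*z′≤v⇒[u*v]*z≤𝟘 z (G x y (z ′))

    𝟘*x′≤𝟘*x′′ : ∀ x → 𝟘 * x ′ ≤ 𝟘 * x ′ ′
    𝟘*x′≤𝟘*x′′ x = u≤w′⇒𝟘*w≤𝟘*w′ (subst (λ t → x ′ * c ≤ (x * t) ′) c≤𝟘 (G x 𝟘 c))
      where
      c : X
      c = ((𝟘 * 𝟘) * ((𝟘 * 𝟘 ′ ′) * 𝟘)) * 𝟘

      c≤𝟘 : c ≤ 𝟘
      c≤𝟘 = [[x*y]*[[x*z′′]*y]]*z≤𝟘 𝟘 𝟘 𝟘

    [𝟘*[𝟘*x′′]]*x≤𝟘 : ∀ x → (𝟘 * (𝟘 * x ′ ′)) * x ≤ 𝟘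
    [𝟘*[𝟘*x′′]]*x≤𝟘 x = u*z′≤v⇒[u*v]*z≤𝟘 x (𝟘*x′≤𝟘*x′′ x)

    𝟘≤[x′*y]′*[x*y′′] : ∀ x y → 𝟘 ≤ (x ′ * y) ′ * (x * y ′ ′)
    𝟘≤[x′*y]′*[x*y′′] x y =
      u*z≤w≤𝟘⇒𝟘≤u′*z (G (x ′) y (x * y ′ ′)) ([[x*y]*[[x*z′′]*y]]*z≤𝟘 x 𝟘 y)

    𝟘≤𝟘′ : 𝟘 ≤ 𝟘 ′
    𝟘≤𝟘′ = subst₂ (λ s t → 𝟘 ≤ s * t) 𝟘′*[𝟘*w]≤𝟘 𝟘≤[𝟘*w]′′
      (𝟘≤[x′*y]′*[x*y′′] 𝟘 (𝟘 * w))
      where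
      w : X
      w = 𝟘 * (𝟘 * 𝟘 ′ ′)

      w′≤𝟘 : w ′ ≤ 𝟘
      w′≤𝟘 = [𝟘*[𝟘*x′′]]*x≤𝟘 𝟘

      [𝟘*𝟘′]*w≤𝟘 : (𝟘 * 𝟘 ′) * w ≤ 𝟘
      [𝟘*𝟘′]*w≤𝟘 = subst (λ t → (𝟘 * (𝟘 * t)) * w ≤ 𝟘) w′≤𝟘 ([𝟘*[𝟘*x′′]]*x≤𝟘 w)

      𝟘≤[𝟘*w]′′ : 𝟘 ≤ (𝟘 * w) ′ ′
      𝟘≤[𝟘*w]′′ = u*z≤w≤𝟘⇒𝟘≤u′*z (G 𝟘 w 𝟘) [𝟘*𝟘′]*w≤𝟘

      𝟘′*[𝟘*w]≤𝟘 : 𝟘 ′ * (𝟘 * w) ≤ 𝟘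
      𝟘′*[𝟘*w]≤𝟘 =
        subst (λ t → (𝟘 * t) * (𝟘 * w) ≤ 𝟘) 𝟘≤[𝟘*w]′′ ([𝟘*[𝟘*x′′]]*x≤𝟘 (𝟘 * w))

    𝟘′≤𝟘*𝟘′ : 𝟘 ′ ≤ 𝟘 * 𝟘 ′
    𝟘′≤𝟘*𝟘′ = u≤w′⇒𝟘*w≤𝟘*w′ (u≤w′⇒[u*y]*w≤𝟘*y 𝟘 (G 𝟘 𝟘 𝟘))

    𝟘′≡𝟘 : 𝟘 ′ ≡ 𝟘
    𝟘′≡𝟘 = A3 (𝟘 ′) 𝟘 (subst (𝟘 ′ ≤_) 𝟘≤𝟘′ 𝟘′≤𝟘*𝟘′) 𝟘≤𝟘′

    𝟘′′≡𝟘 : 𝟘 ′ ′ ≡ 𝟘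
    𝟘′′≡𝟘 = trans (cong _′ 𝟘′≡𝟘) 𝟘′≡𝟘

    ≤𝟘⇒≡𝟘 : ∀ {x} → x ≤ 𝟘 → x ≡ 𝟘
    ≤𝟘⇒≡𝟘 {x} x≤𝟘 = A3 x 𝟘 x≤𝟘 (A3 (𝟘 * x) 𝟘 𝟘*x≤𝟘 𝟘≤𝟘*x)
      where
      𝟘*x≤𝟘 : 𝟘 * x ≤ 𝟘
      𝟘*x≤𝟘 = subst₂ (λ s t → s * x ≤ t)
        𝟘′≡𝟘 (trans (cong (λ t → (𝟘 * t) ′) x≤𝟘) 𝟘′′≡𝟘) (G 𝟘 𝟘 x)

      𝟘≤𝟘*x : 𝟘 ≤ 𝟘 * x
      𝟘≤𝟘*x = subst (λ t → 𝟘 ≤ t * x) 𝟘′≡𝟘 (u*z≤w≤𝟘⇒𝟘≤u′*z 𝟘*x≤𝟘 𝟘′≡𝟘)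

    x*y≤x′*y : ∀ x y → x * y ≤ x ′ * y
    x*y≤x′*y x y = ≤𝟘⇒≡𝟘 (≤𝟘⇒≡𝟘
      (subst (λ t → ((x * y) * ((x * t) * y)) ′ ≤ 𝟘) 𝟘′′≡𝟘 ([[x*y]*[[x*z′′]*y]]*z≤𝟘 x y 𝟘)))

    x≤x′ : ∀ x → x ≤ x ′
    x≤x′ x = ≤𝟘⇒≡𝟘 (subst (x * x ′ ≤_) x′*x′≡𝟘 (x*y≤x′*y x (x ′)))
      where
      x*x′′≤𝟘 : x * x ′ ′ ≤ 𝟘
      x*x′′≤𝟘 = subst (λ t → (x * x ′ ′) * t ≡ 𝟘) (x*y≤x′*y x 𝟘) (x*y≤x′*y x (x ′ ′))

      x′*x′≡𝟘 : x ′ * x ′ ≡ 𝟘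
      x′*x′≡𝟘 = ≤𝟘⇒≡𝟘 (subst (x ′ * x ′ ≤_) x*x′′≤𝟘 (G x 𝟘 (x ′)))

    x′≤x : ∀ x → x ′ ≤ x
    x′≤x x = ≤𝟘⇒≡𝟘 (subst (x ′ * x ≤_) (trans (cong _′ (x≤x′ x)) 𝟘′≡𝟘) (G x 𝟘 x))

    x′≡x : ∀ x → x ′ ≡ x
    x′≡x x = A3 (x ′) x (x′≤x x) (x≤x′ x)

    B1 : ∀ x → x * x ≡ 𝟘
    B1 x = subst (λ t → x * t ≡ 𝟘) (x′≡x x) (x≤x′ x)

    [x*y]*z≤[x*z]*y : ∀ x y z → (x * y) * z ≤ (x * z) * y
    [x*y]*z≤[x*z]*y x y z = subst (λ t → (x * y) * z ≤ (x * t) * y) (x′≡x z) (G x y z)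

    B3 : ∀ x y z → (x * y) * z ≡ (x * z) * y
    B3 x y z = A3 ((x * y) * z) ((x * z) * y) ([x*y]*z≤[x*z]*y x y z) ([x*y]*z≤[x*z]*y x z y)

theorem1 : ∀ {a} (X : Set a) (_*_ : X → X → X) (𝟘 : X) →
               IsBCH X _*_ 𝟘 ⇔ IsGA3 X _*_ 𝟘
theorem1 X _*_ 𝟘 = mk⇔
  (λ (B1 , B2 , B3) → FromBCH.G _*_ 𝟘 B1 B2 B3 , B2)
  (λ (G , A3) → let open FromGA3 _*_ 𝟘 G A3 in B1 , A3 , B3)
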